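{- Let $W(n)$ be the number of brindled quadruples of vectors of the Boolean $(n+1)$-dimensional hypercube $\mathbb{Z}_2^{n+1}$. Then $W(n)=\frac{1}{32}\left(6^n-2^n\right)$ if $n$ is even, and $W(n)=\frac{1}{32}\left(6^n-3\cdot 2^n\right)$ if $n$ is odd.
   Context: A quadruple is a multiset of four Boolean vectors; a quadruple of $(n+1)$-vectors is proper if in every coordinate its four entries form the multiset $\{0,0,1,1\}$; worthwhile if it is proper and each vector has even weight (even number of ones); brindled if it is worthwhile and its four vectors are pairwise distinct. Quadruples are counted as unordered. -}

module Defs where

open import Data.Bool using (Bool; true; false; _∧_; not)
open import Data.Nat using (ℕ; zero; suc; _≡ᵇ_; _%_)
open import Data.Fin using (Fin)
open import Data.Vec using (Vec; []; _∷_; lookup)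
open import Data.List using (List; []; _∷_; map; _++_; length; allFin; filterᵇ)

all : {A : Set} → (A → Bool) → List A → Bool
all p [] = true
all p (x ∷ xs) = p x ∧ all p xs

cube : (m : ℕ) → List (Vec Bool m)
cube zero = [] ∷ []
cube (suc m) = map (false ∷_) (cube m) ++ map (true ∷_) (cube m)

-- All multisets of size k of elements of a list (without repeated
-- elements), each listed exactly once (combinations with repetition).
multisets : {A : Set} → ℕ → List A → List (List A)
multisets zero _ = [] ∷ []
multisets (suc k) [] = []
multisets (suc k) (x ∷ xs) = map (x ∷_) (multisets k (x ∷ xs)) ++ multisets (suc k) xs

-- Quadruples (unordered, i.e. multisets of four vectors) in Z_2^m.
quadruples : (m : ℕ) → List (List (Vec Bool m))
quadruples m = multisets 4 (cube m)

countT : List Bool → ℕ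
countT [] = 0
countT (true ∷ bs) = suc (countT bs)
countT (false ∷ bs) = countT bs

weight : {m : ℕ} → Vec Bool m → ℕ
weight [] = 0
weight (true ∷ v) = suc (weight v)
weight (false ∷ v) = weight v

eqV : {m : ℕ} → Vec Bool m → Vec Bool m → Bool
eqV [] [] = true
eqV (true ∷ u) (true ∷ v) = eqV u v
eqV (false ∷ u) (false ∷ v) = eqV u v
eqV (true ∷ u) (false ∷ v) = false
eqV (false ∷ u) (true ∷ v) = false

-- proper: in every coordinate the four entries form the multiset {0,0,1,1}
-- (the quadruple has four entries, so this means exactly two are 1).
proper : {m : ℕ} → List (Vec Bool m) → Bool
proper {m} q = (length q ≡ᵇ 4) ∧ all (λ i → countT (map (lookup' i) q) ≡ᵇ 2) (allFin m)
  where
  lookup' : Fin m → Vec Bool m → Bool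
  lookup' i v = lookup v i

worthwhile : {m : ℕ} → List (Vec Bool m) → Bool
worthwhile q = proper q ∧ all (λ v → weight v % 2 ≡ᵇ 0) q

distinct : {m : ℕ} → List (Vec Bool m) → Bool
distinct [] = true
distinct (v ∷ vs) = all (λ w → not (eqV v w)) vs ∧ distinct vs

brindled : {m : ℕ} → List (Vec Bool m) → Bool
brindled q = worthwhile q ∧ distinct q

W : ℕ → ℕ
W n = length (filterᵇ brindled (quadruples (suc n)))

-- Split each vector of Z₂^(n+1) into its first coordinate and the rest. The first coordinate of a
-- brindled quadruple has exactly two ones, so W(n) counts the pairs of 2-multisets {x, y}, {z, w} of
-- Z₂^n for which {0x, 0y, 1z, 1w} is brindled. Since brindledness depends only on the multiset, 4 W(n)
-- counts ordered quadruples (x, y, z, w) with x ≠ y and z ≠ w, two ones in every column, x and y of even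
-- and z and w of odd weight. Two ones per column make x = y equivalent to z = w, so 4 W(n) = N(n) − E(n),
-- where N counts such quadruples without the distinctness conditions and E those among them with x = y.
-- Appending a column shifts the vector of weight parities by that column; the resulting linear recursion
-- keeps the count in the span of three indicators (all parities even, all odd, parity vector an admissible
-- column), and solving it gives 8 N(n) = 6^n − (−2)^n, while E(n) is 2^(n−1) for odd n and 0 for even n.
module Submission where

open import Defs
open import Data.Nat using (ℕ; _+_; _*_; _^_; _%_)
open import Data.Product using (_×_)
open import Relation.Binary.PropositionalEquality using (_≡_)

open import Data.Bool using (Bool; true; false; _∧_; not; _xor_; T)
open import Data.Bool.Properties using (∧-assoc; ∧-identityʳ; ∧-zeroʳ; ∧-commutativeMonoid; not-involutive)
open import Data.Empty using (⊥-elim)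
open import Data.Fin using (Fin; zero; suc; #_)
import Data.Fin as Fin
open import Data.List using (List; []; _∷_; _++_; map; length; filterᵇ; upTo; tabulate; allFin)
open import Data.List.Properties using (map-++; map-∘; map-cong; map-cong-local; map-applyUpTo)
open import Data.List.Relation.Binary.Permutation.Propositional
  using (_↭_; prep; swap) renaming (refl to ↭-refl; trans to ↭-trans)
open import Data.List.Relation.Binary.Permutation.Propositional.Properties using (↭-length; map⁺; ++⁺ˡ; ++-comm)
open import Data.List.Relation.Unary.All using (All; []; _∷_)
import Data.List.Relation.Unary.All as All
open import Data.List.Relation.Unary.All.Properties using (++⁺) renaming (map⁺ to All-map⁺)
open import Data.Nat using (zero; suc; _∸_; _≡ᵇ_; _/_)
open import Data.Nat.DivMod using (m≡m%n+[m/n]*n; %-distribˡ-+)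
open import Data.Nat.ListAction using (sum)
open import Data.Nat.ListAction.Properties using (sum-++; sum-↭)
open import Data.Nat.Properties
  using (+-identityʳ; *-assoc; *-zeroʳ; *-distribˡ-+; +-cancelʳ-≡; +-commutativeSemigroup; ≡ᵇ⇒≡)
open import Data.Nat.Tactic.RingSolver using (solve-∀)
open import Data.Product using (_,_; proj₁; proj₂)
open import Data.Vec using (Vec; []; _∷_; head; tail; lookup; zipWith; replicate; toList)
import Data.Vec as Vec
open import Data.Vec.Properties using (lookup-map)
open import Function using (_∘_; id)
open import Relation.Binary.PropositionalEquality
  using (_≢_; refl; sym; trans; cong; cong₂; subst; module ≡-Reasoning)
open import Relation.Nullary using (¬_)

open import Algebra.Bundles using (CommutativeMonoid)
open import Algebra.Properties.CommutativeSemigroup +-commutativeSemigroup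
  using () renaming (interchange to +-interchange; x∙yz≈y∙xz to +-leftComm)
open import Algebra.Properties.CommutativeSemigroup (CommutativeMonoid.commutativeSemigroup ∧-commutativeMonoid)
  using () renaming (interchange to ∧-interchange; x∙yz≈y∙xz to ∧-leftComm)

private
  variable
    A B : Set
    k m : ℕ

toℕ : Bool → ℕ
toℕ false = 0
toℕ true  = 1

toℕ-∧ : ∀ a b → toℕ (a ∧ b) ≡ toℕ a * toℕ b
toℕ-∧ false b = refl
toℕ-∧ true  b = sym (+-identityʳ (toℕ b))

toℕ-¬T : ∀ {b} → ¬ T b → toℕ b ≡ 0
toℕ-¬T {false} _  = refl
toℕ-¬T {true}  ¬t = ⊥-elim (¬t _)

toℕ-injective : ∀ {a b} → toℕ a ≡ toℕ b → a ≡ b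
toℕ-injective {false} {false} _ = refl
toℕ-injective {true}  {true}  _ = refl
toℕ-injective {false} {true}  ()
toℕ-injective {true}  {false} ()

T-∧ˡ : ∀ a b → T (a ∧ b) → T a
T-∧ˡ true b _ = _

T-∧ʳ : ∀ a b → T (a ∧ b) → T b
T-∧ʳ true b t = t

-- Matches on the expected bit, so that `p == false` reduces to `not p`.
infix 5 _==_
_==_ : Bool → Bool → Bool
a == true  = a
a == false = not a

xor-== : ∀ a p b → (a xor p) == b ≡ p == (a xor b)
xor-== false p b     = refl
xor-== true  p true  = refl
xor-== true  p false = not-involutive p

eqV-∷ : ∀ a b (u v : Vec Bool m) → eqV (a ∷ u) (b ∷ v) ≡ (a == b) ∧ eqV u v
eqV-∷ true  true  u v = refl
eqV-∷ true  false u v = refl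
eqV-∷ false true  u v = refl
eqV-∷ false false u v = refl

eqV-sym : (u v : Vec Bool m) → eqV u v ≡ eqV v u
eqV-sym []          []          = refl
eqV-sym (true ∷ u)  (true ∷ v)  = eqV-sym u v
eqV-sym (false ∷ u) (false ∷ v) = eqV-sym u v
eqV-sym (true ∷ u)  (false ∷ v) = refl
eqV-sym (false ∷ u) (true ∷ v)  = refl

eqV-refl : (u : Vec Bool m) → eqV u u ≡ true
eqV-refl []          = refl
eqV-refl (true ∷ u)  = eqV-refl u
eqV-refl (false ∷ u) = eqV-refl u

eqV-head-tail : (u v : Vec Bool (suc m)) → eqV u v ≡ (head u == head v) ∧ eqV (tail u) (tail v)
eqV-head-tail (a ∷ u) (b ∷ v) = eqV-∷ a b u v

eqV-[] : (u v : Vec Bool 0) → eqV u v ≡ true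
eqV-[] [] [] = refl

∑ : (A → ℕ) → List A → ℕ
∑ f xs = sum (map f xs)

infix 5 ∑
syntax ∑ (λ x → e) xs = ∑[ x ∈ xs ] e

∑-++ : (f : A → ℕ) (xs ys : List A) → ∑ f (xs ++ ys) ≡ ∑ f xs + ∑ f ys
∑-++ f xs ys = trans (cong sum (map-++ f xs ys)) (sum-++ (map f xs) (map f ys))

∑-map : (f : B → ℕ) (g : A → B) (xs : List A) → ∑ f (map g xs) ≡ ∑ (f ∘ g) xs
∑-map f g xs = cong sum (sym (map-∘ xs))

∑-cong : {f g : A → ℕ} (xs : List A) → (∀ x → f x ≡ g x) → ∑ f xs ≡ ∑ g xs
∑-cong xs f≗g = cong sum (map-cong f≗g xs)

∑-cong-All : {f g : A → ℕ} {xs : List A} → All (λ x → f x ≡ g x) xs → ∑ f xs ≡ ∑ g xs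
∑-cong-All eqs = cong sum (map-cong-local eqs)

∑-zero : (xs : List A) → ∑[ x ∈ xs ] 0 ≡ 0
∑-zero []       = refl
∑-zero (x ∷ xs) = ∑-zero xs

∑-+ : (f g : A → ℕ) (xs : List A) → ∑[ x ∈ xs ] (f x + g x) ≡ ∑ f xs + ∑ g xs
∑-+ f g []       = refl
∑-+ f g (x ∷ xs) = trans (cong (f x + g x +_) (∑-+ f g xs)) (+-interchange (f x) (g x) (∑ f xs) (∑ g xs))

∑-*ˡ : (c : ℕ) (f : A → ℕ) (xs : List A) → ∑[ x ∈ xs ] c * f x ≡ c * ∑ f xs
∑-*ˡ c f []       = sym (*-zeroʳ c)
∑-*ˡ c f (x ∷ xs) = trans (cong (c * f x +_) (∑-*ˡ c f xs)) (sym (*-distribˡ-+ c (f x) (∑ f xs)))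

∑-comm : (f : A → B → ℕ) (xs : List A) (ys : List B) →
         ∑[ x ∈ xs ] ∑[ y ∈ ys ] f x y ≡ ∑[ y ∈ ys ] ∑[ x ∈ xs ] f x y
∑-comm f []       ys = sym (∑-zero ys)
∑-comm f (x ∷ xs) ys = trans (cong (∑ (f x) ys +_) (∑-comm f xs ys)) (sym (∑-+ (f x) _ ys))

∑-upTo-suc : (h : ℕ → ℕ) (k : ℕ) → ∑ h (upTo (suc k)) ≡ h 0 + (∑[ j ∈ upTo k ] h (suc j))
∑-upTo-suc h k = cong (h 0 +_) (trans (cong (∑ h) (sym (map-applyUpTo id suc k))) (∑-map h suc (upTo k)))

length-filterᵇ : (p : A → Bool) (xs : List A) → length (filterᵇ p xs) ≡ ∑[ x ∈ xs ] toℕ (p x)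
length-filterᵇ p []       = refl
length-filterᵇ p (x ∷ xs) with p x
... | true  = cong suc (length-filterᵇ p xs)
... | false = length-filterᵇ p xs

multisets-map : (g : A → B) (k : ℕ) (xs : List A) →
                multisets k (map g xs) ≡ map (map g) (multisets k xs)
multisets-map g zero    xs       = refl
multisets-map g (suc k) []       = refl
multisets-map g (suc k) (x ∷ xs) = begin
  map (g x ∷_) (multisets k (map g (x ∷ xs))) ++ multisets (suc k) (map g xs)
    ≡⟨ cong₂ (λ u v → map (g x ∷_) u ++ v) (multisets-map g k (x ∷ xs)) (multisets-map g (suc k) xs) ⟩
  map (g x ∷_) (map (map g) (multisets k (x ∷ xs))) ++ map (map g) (multisets (suc k) xs)
    ≡⟨ cong (_++ _) (trans (sym (map-∘ (multisets k (x ∷ xs)))) (map-∘ (multisets k (x ∷ xs)))) ⟩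
  map (map g) (map (x ∷_) (multisets k (x ∷ xs))) ++ map (map g) (multisets (suc k) xs)
    ≡⟨ sym (map-++ (map g) (map (x ∷_) (multisets k (x ∷ xs))) (multisets (suc k) xs)) ⟩
  map (map g) (map (x ∷_) (multisets k (x ∷ xs)) ++ multisets (suc k) xs) ∎
  where open ≡-Reasoning

multisets-length : (k : ℕ) (xs : List A) → All (λ q → length q ≡ k) (multisets k xs)
multisets-length zero    xs       = refl ∷ []
multisets-length (suc k) []       = []
multisets-length (suc k) (x ∷ xs) =
  ++⁺ (All-map⁺ (All.map (cong suc) (multisets-length k (x ∷ xs)))) (multisets-length (suc k) xs)

∑-multisets-++ : (f : List A → ℕ) (k : ℕ) (xs ys : List A) →
  ∑ f (multisets k (xs ++ ys)) ≡
  ∑[ j ∈ upTo (suc k) ] ∑[ a ∈ multisets j xs ] ∑[ b ∈ multisets (k ∸ j) ys ] f (a ++ b)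
∑-multisets-++ f zero    xs       ys = sym (trans (+-identityʳ _) (+-identityʳ _))
∑-multisets-++ f (suc k) []       ys = begin
  F                              ≡⟨ sym (+-identityʳ F) ⟩
  F + 0                          ≡⟨ sym (+-identityʳ (F + 0)) ⟩
  F + 0 + 0                      ≡⟨ cong (F + 0 +_) (sym (∑-zero (upTo (suc k)))) ⟩
  F + 0 + (∑[ j ∈ upTo (suc k) ] 0) ≡⟨ sym (∑-upTo-suc H (suc k)) ⟩
  ∑[ j ∈ upTo (suc (suc k)) ] ∑[ a ∈ multisets j [] ] ∑[ b ∈ multisets (suc k ∸ j) ys ] f (a ++ b) ∎
  where
  open ≡-Reasoning
  F = ∑ f (multisets (suc k) ys)
  H : ℕ → ℕ
  H j = ∑[ a ∈ multisets j [] ] ∑[ b ∈ multisets (suc k ∸ j) ys ] f (a ++ b)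
∑-multisets-++ f (suc k) (x ∷ xs) ys = begin
  ∑ f (map (x ∷_) (multisets k (x ∷ xs ++ ys)) ++ multisets (suc k) (xs ++ ys))
    ≡⟨ trans (∑-++ f (map (x ∷_) (multisets k (x ∷ xs ++ ys))) (multisets (suc k) (xs ++ ys)))
             (cong (_+ ∑ f (multisets (suc k) (xs ++ ys))) (∑-map f (x ∷_) (multisets k (x ∷ xs ++ ys)))) ⟩
  ∑ (f ∘ (x ∷_)) (multisets k (x ∷ xs ++ ys)) + ∑ f (multisets (suc k) (xs ++ ys))
    ≡⟨ cong₂ _+_ (∑-multisets-++ (f ∘ (x ∷_)) k (x ∷ xs) ys) (∑-multisets-++ f (suc k) xs ys) ⟩
  (∑[ j ∈ upTo (suc k) ] P j) + (∑[ j ∈ upTo (suc (suc k)) ] Q j)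
    ≡⟨ cong ((∑[ j ∈ upTo (suc k) ] P j) +_) (∑-upTo-suc Q (suc k)) ⟩
  (∑[ j ∈ upTo (suc k) ] P j) + (Q 0 + (∑[ j ∈ upTo (suc k) ] Q (suc j)))
    ≡⟨ +-leftComm (∑[ j ∈ upTo (suc k) ] P j) (Q 0) (∑[ j ∈ upTo (suc k) ] Q (suc j)) ⟩
  Q 0 + ((∑[ j ∈ upTo (suc k) ] P j) + (∑[ j ∈ upTo (suc k) ] Q (suc j)))
    ≡⟨ cong (Q 0 +_) (sym (∑-+ P (Q ∘ suc) (upTo (suc k)))) ⟩
  Q 0 + (∑[ j ∈ upTo (suc k) ] (P j + Q (suc j)))
    ≡⟨ cong (Q 0 +_) (∑-cong (upTo (suc k)) λ j → sym (split j)) ⟩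
  Q 0 + (∑[ j ∈ upTo (suc k) ] ∑[ a ∈ multisets (suc j) (x ∷ xs) ] G (k ∸ j) a)
    ≡⟨ sym (∑-upTo-suc (λ j → ∑[ a ∈ multisets j (x ∷ xs) ] G (suc k ∸ j) a) (suc k)) ⟩
  ∑[ j ∈ upTo (suc (suc k)) ] ∑[ a ∈ multisets j (x ∷ xs) ] G (suc k ∸ j) a ∎
  where
  open ≡-Reasoning
  G : ℕ → List _ → ℕ
  G i a = ∑[ b ∈ multisets i ys ] f (a ++ b)
  P Q : ℕ → ℕ
  P j = ∑[ a ∈ multisets j (x ∷ xs) ] G (k ∸ j) (x ∷ a)
  Q j = ∑[ a ∈ multisets j xs ] G (suc k ∸ j) a
  split : ∀ j → ∑[ a ∈ multisets (suc j) (x ∷ xs) ] G (k ∸ j) a ≡ P j + Q (suc j)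
  split j = trans (∑-++ (G (k ∸ j)) (map (x ∷_) (multisets j (x ∷ xs))) (multisets (suc j) xs))
                  (cong (_+ Q (suc j)) (∑-map (G (k ∸ j)) (x ∷_) (multisets j (x ∷ xs))))

multisets-1 : (xs : List A) → multisets 1 xs ≡ map (_∷ []) xs
multisets-1 []       = refl
multisets-1 (x ∷ xs) = cong ((x ∷ []) ∷_) (multisets-1 xs)

∑-multisets-2 : (h : List A → ℕ) → (∀ x y → h (x ∷ y ∷ []) ≡ h (y ∷ x ∷ [])) → (xs : List A) →
  2 * ∑ h (multisets 2 xs) ≡ (∑[ x ∈ xs ] ∑[ y ∈ xs ] h (x ∷ y ∷ [])) + (∑[ x ∈ xs ] h (x ∷ x ∷ []))
∑-multisets-2 h h-sym []       = refl
∑-multisets-2 h h-sym (x ∷ xs) = begin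
  2 * (h (x ∷ x ∷ []) + ∑ h (map (x ∷_) (multisets 1 xs) ++ multisets 2 xs))
    ≡⟨ cong (λ t → 2 * (h (x ∷ x ∷ []) + t))
            (trans (∑-++ h (map (x ∷_) (multisets 1 xs)) (multisets 2 xs)) (cong (_+ ∑ h (multisets 2 xs)) row)) ⟩
  2 * (h (x ∷ x ∷ []) + (R + ∑ h (multisets 2 xs)))
    ≡⟨ double-pairs (h (x ∷ x ∷ [])) R _ _ _ (∑-multisets-2 h h-sym xs) ⟩
  (h (x ∷ x ∷ []) + R) + (R + Q) + (h (x ∷ x ∷ []) + D)
    ≡⟨ cong (λ t → (h (x ∷ x ∷ []) + R) + t + (h (x ∷ x ∷ []) + D))
            (trans (cong (_+ Q) (∑-cong xs (λ y → h-sym x y)))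
                   (sym (∑-+ (λ u → h (u ∷ x ∷ [])) (λ u → ∑[ y ∈ xs ] h (u ∷ y ∷ [])) xs))) ⟩
  (∑[ u ∈ x ∷ xs ] ∑[ y ∈ x ∷ xs ] h (u ∷ y ∷ [])) + (∑[ u ∈ x ∷ xs ] h (u ∷ u ∷ [])) ∎
  where
  open ≡-Reasoning
  R = ∑[ y ∈ xs ] h (x ∷ y ∷ [])
  Q = ∑[ u ∈ xs ] ∑[ y ∈ xs ] h (u ∷ y ∷ [])
  D = ∑[ u ∈ xs ] h (u ∷ u ∷ [])
  row : ∑ h (map (x ∷_) (multisets 1 xs)) ≡ R
  row = trans (∑-map h (x ∷_) (multisets 1 xs))
              (trans (cong (∑ (h ∘ (x ∷_))) (multisets-1 xs)) (∑-map (h ∘ (x ∷_)) (_∷ []) xs))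
  double-pairs : ∀ a r s q d → 2 * s ≡ q + d → 2 * (a + (r + s)) ≡ (a + r) + (r + q) + (a + d)
  double-pairs a r s q d 2s≡q+d = trans (expand a r s) (trans (cong ((a + r) + r + a +_) 2s≡q+d) (regroup a r q d))
    where
    expand : ∀ a r s → 2 * (a + (r + s)) ≡ (a + r) + r + a + 2 * s
    expand = solve-∀
    regroup : ∀ a r q d → (a + r) + r + a + (q + d) ≡ (a + r) + (r + q) + (a + d)
    regroup = solve-∀

all-cong : {p q : A → Bool} (xs : List A) → (∀ x → p x ≡ q x) → all p xs ≡ all q xs
all-cong []       p≗q = refl
all-cong (x ∷ xs) p≗q = cong₂ _∧_ (p≗q x) (all-cong xs p≗q)

all-++ : (p : A → Bool) (xs ys : List A) → all p (xs ++ ys) ≡ all p xs ∧ all p ys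
all-++ p []       ys = refl
all-++ p (x ∷ xs) ys = trans (cong (p x ∧_) (all-++ p xs ys)) (sym (∧-assoc (p x) (all p xs) (all p ys)))

all-map : (p : B → Bool) (f : A → B) (xs : List A) → all p (map f xs) ≡ all (p ∘ f) xs
all-map p f []       = refl
all-map p f (x ∷ xs) = cong (p (f x) ∧_) (all-map p f xs)

all-tabulate : (p : A → Bool) (f : Fin m → A) → all p (tabulate f) ≡ all (p ∘ f) (allFin m)
all-tabulate {m = zero}  p f = refl
all-tabulate {m = suc m} p f =
  cong (p (f zero) ∧_) (trans (all-tabulate p (f ∘ suc)) (sym (all-tabulate (p ∘ f) suc)))

all-cube-halves : (p : Vec Bool (suc k) → Bool) → T (all p (cube (suc k))) →
                  T (all (p ∘ (false ∷_)) (cube k)) × T (all (p ∘ (true ∷_)) (cube k))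
all-cube-halves {k} p all-p = T-∧ˡ (all (p ∘ (false ∷_)) (cube k)) _ (subst T halves all-p) ,
                              T-∧ʳ (all (p ∘ (false ∷_)) (cube k)) _ (subst T halves all-p)
  where
  halves : all p (cube (suc k)) ≡ all (p ∘ (false ∷_)) (cube k) ∧ all (p ∘ (true ∷_)) (cube k)
  halves = trans (all-++ p (map (false ∷_) (cube k)) (map (true ∷_) (cube k)))
                 (cong₂ _∧_ (all-map p (false ∷_) (cube k)) (all-map p (true ∷_) (cube k)))

all-cube : (p : Vec Bool k → Bool) → T (all p (cube k)) → ∀ v → T (p v)
all-cube {zero}  p all-p []          = T-∧ˡ (p []) true all-p
all-cube {suc k} p all-p (false ∷ v) = all-cube (p ∘ (false ∷_)) (proj₁ (all-cube-halves p all-p)) v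
all-cube {suc k} p all-p (true ∷ v)  = all-cube (p ∘ (true ∷_)) (proj₂ (all-cube-halves p all-p)) v

≗-on-cube : (f g : Vec Bool k → ℕ) → T (all (λ v → f v ≡ᵇ g v) (cube k)) → ∀ v → f v ≡ g v
≗-on-cube f g checked v = ≡ᵇ⇒≡ (f v) (g v) (all-cube (λ v → f v ≡ᵇ g v) checked v)

-- Brindledness depends only on the multiset

countT≡sum : (bs : List Bool) → countT bs ≡ sum (map toℕ bs)
countT≡sum []           = refl
countT≡sum (true ∷ bs)  = cong suc (countT≡sum bs)
countT≡sum (false ∷ bs) = countT≡sum bs

countT-↭ : {bs cs : List Bool} → bs ↭ cs → countT bs ≡ countT cs
countT-↭ {bs} {cs} bs↭cs = trans (countT≡sum bs) (trans (sum-↭ (map⁺ toℕ bs↭cs)) (sym (countT≡sum cs)))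

all-↭ : (p : A → Bool) {xs ys : List A} → xs ↭ ys → all p xs ≡ all p ys
all-↭ p ↭-refl        = refl
all-↭ p (prep x xs↭ys) = cong (p x ∧_) (all-↭ p xs↭ys)
all-↭ p (swap x y xs↭ys) = trans (cong (λ t → p x ∧ (p y ∧ t)) (all-↭ p xs↭ys)) (∧-leftComm (p x) (p y) _)
all-↭ p (↭-trans xs↭ys ys↭zs) = trans (all-↭ p xs↭ys) (all-↭ p ys↭zs)

distinct-↭ : {xs ys : List (Vec Bool m)} → xs ↭ ys → distinct xs ≡ distinct ys
distinct-↭ ↭-refl        = refl
distinct-↭ (prep x xs↭ys) = cong₂ _∧_ (all-↭ (λ w → not (eqV x w)) xs↭ys) (distinct-↭ xs↭ys)
distinct-↭ {ys = _ ∷ _ ∷ ys} (swap x y xs↭ys)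
  rewrite eqV-sym x y | all-↭ (λ w → not (eqV x w)) xs↭ys | all-↭ (λ w → not (eqV y w)) xs↭ys
        | distinct-↭ xs↭ys
  = ∧-interchange (not (eqV y x)) (all (λ w → not (eqV x w)) ys) (all (λ w → not (eqV y w)) ys) (distinct ys)
distinct-↭ (↭-trans xs↭ys ys↭zs) = trans (distinct-↭ xs↭ys) (distinct-↭ ys↭zs)

brindled-↭ : {q q′ : List (Vec Bool m)} → q ↭ q′ → brindled q ≡ brindled q′
brindled-↭ {m} q↭q′ =
  cong₂ _∧_ (cong₂ _∧_ (cong₂ _∧_ (cong (_≡ᵇ 4) (↭-length q↭q′)) (all-cong (allFin m) coordinate))
                       (all-↭ (λ v → weight v % 2 ≡ᵇ 0) q↭q′))
            (distinct-↭ q↭q′)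
  where
  coordinate : ∀ i → _
  coordinate i = cong (_≡ᵇ 2) (countT-↭ (map⁺ (λ v → lookup v i) q↭q′))

brindled-repeat : (v : Vec Bool m) (q : List (Vec Bool m)) → brindled (v ∷ v ∷ q) ≡ false
brindled-repeat v q rewrite eqV-refl v = ∧-zeroʳ (worthwhile (v ∷ v ∷ q))

∑-cube-suc : (f : Vec Bool (suc m) → ℕ) →
             ∑ f (cube (suc m)) ≡ (∑[ v ∈ cube m ] f (false ∷ v)) + (∑[ v ∈ cube m ] f (true ∷ v))
∑-cube-suc {m} f = trans (∑-++ f (map (false ∷_) (cube m)) (map (true ∷_) (cube m)))
                         (cong₂ _+_ (∑-map f (false ∷_) (cube m)) (∑-map f (true ∷_) (cube m)))

∑-tuples : (m : ℕ) → (Vec (Vec Bool m) k → ℕ) → ℕ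
∑-tuples {zero}  m g = g []
∑-tuples {suc k} m g = ∑[ v ∈ cube m ] ∑-tuples m (λ vs → g (v ∷ vs))

∑-tuples-cong : (m : ℕ) {g h : Vec (Vec Bool m) k → ℕ} → (∀ vs → g vs ≡ h vs) →
                ∑-tuples m g ≡ ∑-tuples m h
∑-tuples-cong {zero}  m g≗h = g≗h []
∑-tuples-cong {suc k} m g≗h = ∑-cong (cube m) λ v → ∑-tuples-cong m (λ vs → g≗h (v ∷ vs))

∑-tuples-+ : (m : ℕ) (g h : Vec (Vec Bool m) k → ℕ) →
             ∑-tuples m (λ vs → g vs + h vs) ≡ ∑-tuples m g + ∑-tuples m h
∑-tuples-+ {zero}  m g h = refl
∑-tuples-+ {suc k} m g h =
  trans (∑-cong (cube m) λ v → ∑-tuples-+ m (λ vs → g (v ∷ vs)) (λ vs → h (v ∷ vs)))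
        (∑-+ (λ v → ∑-tuples m (λ vs → g (v ∷ vs))) (λ v → ∑-tuples m (λ vs → h (v ∷ vs))) (cube m))

∑-tuples-*ˡ : (m c : ℕ) (g : Vec (Vec Bool m) k → ℕ) → ∑-tuples m (λ vs → c * g vs) ≡ c * ∑-tuples m g
∑-tuples-*ˡ {zero}  m c g = refl
∑-tuples-*ˡ {suc k} m c g =
  trans (∑-cong (cube m) λ v → ∑-tuples-*ˡ m c (λ vs → g (v ∷ vs)))
        (∑-*ˡ c (λ v → ∑-tuples m (λ vs → g (v ∷ vs))) (cube m))

∑-tuples-zero : (g : Vec (Vec Bool 0) k → ℕ) → ∑-tuples 0 g ≡ g (replicate k [])
∑-tuples-zero {zero}  g = refl
∑-tuples-zero {suc k} g = trans (+-identityʳ _) (∑-tuples-zero (λ vs → g ([] ∷ vs)))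

∑-tuples-suc : (m : ℕ) (g : Vec (Vec Bool (suc m)) k → ℕ) →
               ∑-tuples (suc m) g ≡ ∑[ c ∈ cube k ] ∑-tuples m (λ vs → g (zipWith _∷_ c vs))
∑-tuples-suc {zero}  m g = sym (+-identityʳ (g []))
∑-tuples-suc {suc k} m g = begin
  ∑[ v ∈ cube (suc m) ] ∑-tuples (suc m) (λ vs → g (v ∷ vs))
    ≡⟨ ∑-cong (cube (suc m)) (λ v → ∑-tuples-suc m (λ vs → g (v ∷ vs))) ⟩
  ∑[ v ∈ cube (suc m) ] ∑[ c ∈ cube k ] X v c
    ≡⟨ ∑-cube-suc (λ v → ∑[ c ∈ cube k ] X v c) ⟩
  (∑[ v ∈ cube m ] ∑[ c ∈ cube k ] X (false ∷ v) c) + (∑[ v ∈ cube m ] ∑[ c ∈ cube k ] X (true ∷ v) c)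
    ≡⟨ cong₂ _+_ (∑-comm (X ∘ (false ∷_)) (cube m) (cube k)) (∑-comm (X ∘ (true ∷_)) (cube m) (cube k)) ⟩
  (∑[ c ∈ cube k ] ∑[ v ∈ cube m ] X (false ∷ v) c) + (∑[ c ∈ cube k ] ∑[ v ∈ cube m ] X (true ∷ v) c)
    ≡⟨ sym (∑-cube-suc (λ c → ∑-tuples m (λ vs → g (zipWith _∷_ c vs)))) ⟩
  ∑[ c ∈ cube (suc k) ] ∑-tuples m (λ vs → g (zipWith _∷_ c vs)) ∎
  where
  open ≡-Reasoning
  X : Vec Bool (suc m) → Vec Bool k → ℕ
  X v c = ∑-tuples m (λ vs → g (v ∷ zipWith _∷_ c vs))

-- Tuples of words with prescribed columns and weight parities

parity : Vec Bool m → Bool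
parity []      = false
parity (a ∷ v) = a xor parity v

hasParities : Vec (Vec Bool m) k → Vec Bool k → Bool
hasParities []       []      = true
hasParities (v ∷ vs) (b ∷ s) = (parity v == b) ∧ hasParities vs s

columnsIn : (Vec Bool k → Bool) → Vec (Vec Bool m) k → Bool
columnsIn {m = zero}  C vs = true
columnsIn {m = suc m} C vs = C (Vec.map head vs) ∧ columnsIn C (Vec.map tail vs)

fits : (Vec Bool k → Bool) → Vec (Vec Bool m) k → Vec Bool k → Bool
fits C vs s = columnsIn C vs ∧ hasParities vs s

count : (Vec Bool k → Bool) → ℕ → Vec Bool k → ℕ
count C m s = ∑-tuples m (λ vs → toℕ (fits C vs s))

infixl 6 _⊕_
_⊕_ : Vec Bool k → Vec Bool k → Vec Bool k
_⊕_ = zipWith _xor_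

step : (Vec Bool k → Bool) → (Vec Bool k → ℕ) → Vec Bool k → ℕ
step {k} C f s = ∑[ c ∈ cube k ] toℕ (C c) * f (c ⊕ s)

heads-zipWith : (c : Vec Bool k) (vs : Vec (Vec Bool m) k) → Vec.map head (zipWith _∷_ c vs) ≡ c
heads-zipWith []      []       = refl
heads-zipWith (a ∷ c) (v ∷ vs) = cong (a ∷_) (heads-zipWith c vs)

tails-zipWith : (c : Vec Bool k) (vs : Vec (Vec Bool m) k) → Vec.map tail (zipWith _∷_ c vs) ≡ vs
tails-zipWith []      []       = refl
tails-zipWith (a ∷ c) (v ∷ vs) = cong (v ∷_) (tails-zipWith c vs)

hasParities-zipWith : (c : Vec Bool k) (vs : Vec (Vec Bool m) k) (s : Vec Bool k) →
                      hasParities (zipWith _∷_ c vs) s ≡ hasParities vs (c ⊕ s)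
hasParities-zipWith []      []       []      = refl
hasParities-zipWith (a ∷ c) (v ∷ vs) (b ∷ s) = cong₂ _∧_ (xor-== a (parity v) b) (hasParities-zipWith c vs s)

fits-zipWith : (C : Vec Bool k → Bool) (c : Vec Bool k) (vs : Vec (Vec Bool m) k) (s : Vec Bool k) →
               fits C (zipWith _∷_ c vs) s ≡ C c ∧ fits C vs (c ⊕ s)
fits-zipWith C c vs s
  rewrite heads-zipWith c vs | tails-zipWith c vs | hasParities-zipWith c vs s
  = ∧-assoc (C c) (columnsIn C vs) (hasParities vs (c ⊕ s))

count-suc : (C : Vec Bool k → Bool) (m : ℕ) (s : Vec Bool k) → count C (suc m) s ≡ step C (count C m) s
count-suc {k} C m s = trans (∑-tuples-suc m (λ vs → toℕ (fits C vs s))) (∑-cong (cube k) column)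
  where
  column : ∀ c → ∑-tuples m (λ vs → toℕ (fits C (zipWith _∷_ c vs) s)) ≡ toℕ (C c) * count C m (c ⊕ s)
  column c = trans (∑-tuples-cong m λ vs → trans (cong toℕ (fits-zipWith C c vs s)) (toℕ-∧ (C c) _))
                   (∑-tuples-*ˡ m (toℕ (C c)) (λ vs → toℕ (fits C vs (c ⊕ s))))

hasParities-empty : (s : Vec Bool k) → hasParities (replicate k []) s ≡ eqV s (replicate k false)
hasParities-empty []          = refl
hasParities-empty (true ∷ s)  = refl
hasParities-empty (false ∷ s) = hasParities-empty s

δ : Vec Bool k → Vec Bool k → ℕ
δ t s = toℕ (eqV s t)

count-zero : (C : Vec Bool k → Bool) (s : Vec Bool k) → count C 0 s ≡ δ (replicate k false) s
count-zero {k} C s = trans (∑-tuples-zero (λ vs → toℕ (fits C vs s))) (cong toℕ (hasParities-empty s))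

step-cong : (C : Vec Bool k → Bool) {f g : Vec Bool k → ℕ} → (∀ s → f s ≡ g s) →
            ∀ s → step C f s ≡ step C g s
step-cong {k} C f≗g s = ∑-cong (cube k) λ c → cong (toℕ (C c) *_) (f≗g (c ⊕ s))

step-linear : (C : Vec Bool k → Bool) (x y z : ℕ) (f g h : Vec Bool k → ℕ) (s : Vec Bool k) →
  step C (λ s → x * f s + y * g s + z * h s) s ≡ x * step C f s + y * step C g s + z * step C h s
step-linear {k} C x y z f g h s = begin
  ∑[ c ∈ cube k ] toℕ (C c) * (x * f (c ⊕ s) + y * g (c ⊕ s) + z * h (c ⊕ s))
    ≡⟨ ∑-cong (cube k) (λ c → distribute (toℕ (C c)) x y z (f (c ⊕ s)) (g (c ⊕ s)) (h (c ⊕ s))) ⟩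
  ∑[ c ∈ cube k ] (x * F c + y * G c + z * H c)
    ≡⟨ ∑-+ (λ c → x * F c + y * G c) (λ c → z * H c) (cube k) ⟩
  (∑[ c ∈ cube k ] (x * F c + y * G c)) + (∑[ c ∈ cube k ] z * H c)
    ≡⟨ cong₂ _+_ (trans (∑-+ (λ c → x * F c) (λ c → y * G c) (cube k))
                        (cong₂ _+_ (∑-*ˡ x F (cube k)) (∑-*ˡ y G (cube k))))
                 (∑-*ˡ z H (cube k)) ⟩
  x * step C f s + y * step C g s + z * step C h s ∎
  where
  open ≡-Reasoning
  F G H : Vec Bool k → ℕ
  F c = toℕ (C c) * f (c ⊕ s)
  G c = toℕ (C c) * g (c ⊕ s)
  H c = toℕ (C c) * h (c ⊕ s)
  distribute : ∀ a x y z u v w → a * (x * u + y * v + z * w) ≡ x * (a * u) + y * (a * v) + z * (a * w)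
  distribute = solve-∀

evenCount oddCount mixedCount : (r t m : ℕ) → ℕ
evenCount  r t zero    = 1
evenCount  r t (suc m) = r * mixedCount r t m
oddCount   r t zero    = 0
oddCount   r t (suc m) = r * mixedCount r t m
mixedCount r t zero    = 0
mixedCount r t (suc m) = evenCount r t m + oddCount r t m + t * mixedCount r t m

byClass : (Vec Bool k → Bool) → ℕ → ℕ → ℕ → Vec Bool k → ℕ
byClass {k} C x y z s = x * δ (replicate k false) s + y * δ (replicate k true) s + z * toℕ (C s)

count-byClass : (C : Vec Bool k → Bool) (r t : ℕ) →
  (∀ s → step C (δ (replicate k false)) s ≡ toℕ (C s)) →
  (∀ s → step C (δ (replicate k true)) s ≡ toℕ (C s)) →
  (∀ s → step C (toℕ ∘ C) s ≡ byClass C r r t s) →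
  ∀ m s → count C m s ≡ byClass C (evenCount r t m) (oddCount r t m) (mixedCount r t m) s
count-byClass {k} C r t from-even from-odd from-C zero s =
  trans (count-zero C s) (initial (δ (replicate k false) s) (δ (replicate k true) s) (toℕ (C s)))
  where
  initial : ∀ e o c → e ≡ 1 * e + 0 * o + 0 * c
  initial = solve-∀
count-byClass {k} C r t from-even from-odd from-C (suc m) s = begin
  count C (suc m) s
    ≡⟨ count-suc C m s ⟩
  step C (count C m) s
    ≡⟨ step-cong C (count-byClass C r t from-even from-odd from-C m) s ⟩
  step C (byClass C x y z) s
    ≡⟨ step-linear C x y z (δ (replicate k false)) (δ (replicate k true)) (toℕ ∘ C) s ⟩
  x * step C (δ (replicate k false)) s + y * step C (δ (replicate k true)) s + z * step C (toℕ ∘ C) s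
    ≡⟨ cong₂ _+_ (cong₂ _+_ (cong (x *_) (from-even s)) (cong (y *_) (from-odd s))) (cong (z *_) (from-C s)) ⟩
  x * toℕ (C s) + y * toℕ (C s) + z * byClass C r r t s
    ≡⟨ regroup r t x y z (δ (replicate k false) s) (δ (replicate k true) s) (toℕ (C s)) ⟩
  byClass C (r * z) (r * z) (x + y + t * z) s ∎
  where
  open ≡-Reasoning
  x = evenCount r t m
  y = oddCount r t m
  z = mixedCount r t m
  regroup : ∀ r t x y z e o c →
            x * c + y * c + z * (r * e + r * o + t * c) ≡ r * z * e + r * z * o + (x + y + t * z) * c
  regroup = solve-∀

columnsIn-agree : (C : Vec Bool k → Bool) (i j : Fin k) (vs : Vec (Vec Bool m) k) →
  columnsIn (λ c → C c ∧ (lookup c i == lookup c j)) vs ≡ columnsIn C vs ∧ eqV (lookup vs i) (lookup vs j)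
columnsIn-agree {m = zero}  C i j vs = sym (eqV-[] (lookup vs i) (lookup vs j))
columnsIn-agree {m = suc m} C i j vs
  rewrite lookup-map i head vs | lookup-map j head vs
        | columnsIn-agree C i j (Vec.map tail vs) | lookup-map i tail vs | lookup-map j tail vs
        | eqV-head-tail (lookup vs i) (lookup vs j)
  = ∧-interchange (C (Vec.map head vs)) (head (lookup vs i) == head (lookup vs j))
                  (columnsIn C (Vec.map tail vs)) (eqV (tail (lookup vs i)) (tail (lookup vs j)))

columnsIn-cong : {C C′ : Vec Bool k → Bool} → (∀ c → C c ≡ C′ c) → (vs : Vec (Vec Bool m) k) →
                 columnsIn C vs ≡ columnsIn C′ vs
columnsIn-cong {m = zero}  C≗C′ vs = refl
columnsIn-cong {m = suc m} C≗C′ vs =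
  cong₂ _∧_ (C≗C′ (Vec.map head vs)) (columnsIn-cong C≗C′ (Vec.map tail vs))

balanced : Vec Bool k → Bool
balanced c = countT (toList c) ≡ᵇ 2

pairedBalanced : Vec Bool 4 → Bool
pairedBalanced c = balanced c ∧ (lookup c (# 0) == lookup c (# 1))

-- The hypotheses of count-byClass are checked by evaluating both sides at all 16 parity vectors.
count-balanced : ∀ m (s : Vec Bool 4) →
  count balanced m s ≡ byClass balanced (evenCount 6 4 m) (oddCount 6 4 m) (mixedCount 6 4 m) s
count-balanced = count-byClass balanced 6 4 (≗-on-cube _ _ _) (≗-on-cube _ _ _) (≗-on-cube _ _ _)

count-pairedBalanced : ∀ m s →
  count pairedBalanced m s ≡ byClass pairedBalanced (evenCount 2 0 m) (oddCount 2 0 m) (mixedCount 2 0 m) s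
count-pairedBalanced = count-byClass pairedBalanced 2 0 (≗-on-cube _ _ _) (≗-on-cube _ _ _) (≗-on-cube _ _ _)

pairedBalanced-last-pair : (c : Vec Bool 4) → pairedBalanced c ≡ balanced c ∧ (lookup c (# 2) == lookup c (# 3))
pairedBalanced-last-pair c =
  toℕ-injective (≗-on-cube (toℕ ∘ pairedBalanced) 
    (λ c → toℕ (balanced c ∧ (lookup c (# 2) == lookup c (# 3)))) _ c)

columnsIn-balanced-pairs : (x y z w : Vec Bool m) →
  columnsIn balanced (x ∷ y ∷ z ∷ w ∷ []) ∧ eqV x y ≡
  columnsIn balanced (x ∷ y ∷ z ∷ w ∷ []) ∧ eqV z w
columnsIn-balanced-pairs x y z w =
  trans (sym (columnsIn-agree balanced (# 0) (# 1) vs))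
        (trans (columnsIn-cong pairedBalanced-last-pair vs) (columnsIn-agree balanced (# 2) (# 3) vs))
  where
  vs = x ∷ y ∷ z ∷ w ∷ []

-- Splitting by the first coordinate

prefixed : List (Vec Bool m) → List (Vec Bool m) → List (Vec Bool (suc m))
prefixed a b = map (false ∷_) a ++ map (true ∷_) b

evenEvenOddOdd : Vec Bool 4
evenEvenOddOdd = false ∷ false ∷ true ∷ true ∷ []

prefix0011 : Vec (Vec Bool m) 4 → List (Vec Bool (suc m))
prefix0011 (x ∷ y ∷ z ∷ w ∷ []) = (false ∷ x) ∷ (false ∷ y) ∷ (true ∷ z) ∷ (true ∷ w) ∷ []

weight-%2 : (v : Vec Bool m) → weight v % 2 ≡ toℕ (parity v)
weight-%2 []          = refl
weight-%2 (false ∷ v) = weight-%2 v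
weight-%2 (true ∷ v)  =
  trans (%-distribˡ-+ 1 (weight v) 2) (trans (cong (λ r → (1 + r) % 2) (weight-%2 v)) (flip (parity v)))
  where
  flip : ∀ b → (1 + toℕ b) % 2 ≡ toℕ (not b)
  flip false = refl
  flip true  = refl

weight-even : (v : Vec Bool m) → (weight v % 2 ≡ᵇ 0) ≡ not (parity v)
weight-even v = trans (cong (_≡ᵇ 0) (weight-%2 v)) (toℕ≡ᵇ0 (parity v))
  where
  toℕ≡ᵇ0 : ∀ b → (toℕ b ≡ᵇ 0) ≡ not b
  toℕ≡ᵇ0 false = refl
  toℕ≡ᵇ0 true  = refl

weight-odd : (v : Vec Bool m) → (suc (weight v) % 2 ≡ᵇ 0) ≡ parity v
weight-odd v = trans (weight-even (true ∷ v)) (not-involutive (parity v))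

coordinates-balanced : (x y z w : Vec Bool m) →
  all (λ i → countT (lookup x i ∷ lookup y i ∷ lookup z i ∷ lookup w i ∷ []) ≡ᵇ 2) (allFin m) ≡
  columnsIn balanced (x ∷ y ∷ z ∷ w ∷ [])
coordinates-balanced []      []      []      []      = refl
coordinates-balanced {suc m} (a ∷ x) (b ∷ y) (c ∷ z) (d ∷ w) =
  cong (balanced (a ∷ b ∷ c ∷ d ∷ []) ∧_) (trans (all-tabulate column Fin.suc) (coordinates-balanced x y z w))
  where
  column : Fin (suc m) → Bool
  column i = countT (lookup (a ∷ x) i ∷ lookup (b ∷ y) i ∷ lookup (c ∷ z) i ∷ lookup (d ∷ w) i ∷ [])
             ≡ᵇ 2

brindled-prefix0011 : (x y z w : Vec Bool m) →
  brindled (prefix0011 (x ∷ y ∷ z ∷ w ∷ [])) ≡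
  (fits balanced (x ∷ y ∷ z ∷ w ∷ []) evenEvenOddOdd ∧ not (eqV x y)) ∧ not (eqV z w)
brindled-prefix0011 {m} x y z w =
  assemble (eqV x y) (eqV z w) (trans (all-tabulate column Fin.suc) (coordinates-balanced x y z w))
           (cong₂ _∧_ (weight-even x) (cong₂ _∧_ (weight-even y)
             (cong₂ _∧_ (weight-odd z) (cong₂ _∧_ (weight-odd w) refl))))
  where
  column : Fin (suc m) → Bool
  column i = countT (map (λ v → lookup v i) (prefix0011 (x ∷ y ∷ z ∷ w ∷ []))) ≡ᵇ 2
  assemble : ∀ {c c′ p p′} d d′ → c ≡ c′ → p ≡ p′ →
             (c ∧ p) ∧ ((not d ∧ true) ∧ ((not d′ ∧ true) ∧ true)) ≡
             ((c′ ∧ p′) ∧ not d) ∧ not d′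
  assemble {c} {p = p} d d′ refl refl
    rewrite ∧-identityʳ (not d) | ∧-identityʳ (not d′) | ∧-identityʳ (not d′)
    = sym (∧-assoc (c ∧ p) (not d) (not d′))

first-column-count : (a b : List (Vec Bool m)) →
  countT (map (λ v → lookup v zero) (prefixed a b)) ≡ length b
first-column-count (x ∷ a) b       = first-column-count a b
first-column-count []      []      = refl
first-column-count []      (x ∷ b) = cong suc (first-column-count [] b)

proper⇒first-column : (q : List (Vec Bool (suc m))) → T (proper q) → countT (map (λ v → lookup v zero) q) ≡ 2
proper⇒first-column {m} q proper-q = ≡ᵇ⇒≡ _ 2 (T-∧ˡ (column zero) (all column (tabulate Fin.suc))
                                                  (T-∧ʳ (length q ≡ᵇ 4) (all column (allFin (suc m))) proper-q))
  where
  column : Fin (suc m) → Bool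
  column i = countT (map (λ v → lookup v i) q) ≡ᵇ 2

brindled⇒two-ones : (a b : List (Vec Bool m)) → T (brindled (prefixed a b)) → length b ≡ 2
brindled⇒two-ones a b brindled-q =
  trans (sym (first-column-count a b))
        (proper⇒first-column q (T-∧ˡ (proper q) _ (T-∧ˡ (worthwhile q) (distinct q) brindled-q)))
  where
  q = prefixed a b

W-split : (n : ℕ) → W n ≡
  ∑[ a ∈ multisets 2 (cube n) ] ∑[ b ∈ multisets 2 (cube n) ] toℕ (brindled (prefixed a b))
W-split n = begin
  W n
    ≡⟨ length-filterᵇ brindled (quadruples (suc n)) ⟩
  ∑[ q ∈ multisets 4 (map (false ∷_) C ++ map (true ∷_) C) ] toℕ (brindled q)
    ≡⟨ ∑-multisets-++ (toℕ ∘ brindled) 4 (map (false ∷_) C) (map (true ∷_) C) ⟩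
  ∑[ j ∈ upTo 5 ] ∑[ a ∈ multisets j (map (false ∷_) C) ] ∑[ b ∈ multisets (4 ∸ j) (map (true ∷_) C) ]
    toℕ (brindled (a ++ b))
    ≡⟨ ∑-cong (upTo 5) relabel ⟩
  ∑ H (upTo 5)
    ≡⟨ only-middle (vanish 0 (λ ())) (vanish 1 (λ ())) (vanish 3 (λ ())) (vanish 4 (λ ())) ⟩
  H 2 ∎
  where
  open ≡-Reasoning
  C = cube n
  H : ℕ → ℕ
  H j = ∑[ a ∈ multisets j C ] ∑[ b ∈ multisets (4 ∸ j) C ] toℕ (brindled (prefixed a b))
  relabel : ∀ j → ∑[ a ∈ multisets j (map (false ∷_) C) ] ∑[ b ∈ multisets (4 ∸ j) (map (true ∷_) C) ]
                     toℕ (brindled (a ++ b)) ≡ H j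
  relabel j =
    trans (cong (∑ _) (multisets-map (false ∷_) j C))
          (trans (∑-map _ (map (false ∷_)) (multisets j C))
                 (∑-cong (multisets j C) λ a →
                    trans (cong (∑ _) (multisets-map (true ∷_) (4 ∸ j) C))
                          (∑-map _ (map (true ∷_)) (multisets (4 ∸ j) C))))
  vanish : ∀ j → 4 ∸ j ≢ 2 → H j ≡ 0
  vanish j j≢2 = trans (∑-cong (multisets j C) row-vanishes) (∑-zero (multisets j C))
    where
    row-vanishes : ∀ a → ∑[ b ∈ multisets (4 ∸ j) C ] toℕ (brindled (prefixed a b)) ≡ 0
    row-vanishes a = trans (∑-cong-All (All.map not-brindled (multisets-length (4 ∸ j) C)))
                           (∑-zero (multisets (4 ∸ j) C))
      where
      not-brindled : ∀ {b} → length b ≡ 4 ∸ j → toℕ (brindled (prefixed a b)) ≡ 0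
      not-brindled {b} len-b =
        toℕ-¬T (λ brindled-ab → j≢2 (trans (sym len-b) (brindled⇒two-ones a b brindled-ab)))
  only-middle : ∀ {h₀ h₁ h₂ h₃ h₄} → h₀ ≡ 0 → h₁ ≡ 0 → h₃ ≡ 0 → h₄ ≡ 0 →
                h₀ + (h₁ + (h₂ + (h₃ + (h₄ + 0)))) ≡ h₂
  only-middle refl refl refl refl = +-identityʳ _

W-ordered : (n : ℕ) → 4 * W n ≡ ∑-tuples n (λ vs → toℕ (brindled (prefix0011 vs)))
W-ordered n = begin
  4 * W n
    ≡⟨ cong (4 *_) (W-split n) ⟩
  4 * ∑ H (multisets 2 C)
    ≡⟨ *-assoc 2 2 (∑ H (multisets 2 C)) ⟩
  2 * (2 * ∑ H (multisets 2 C))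
    ≡⟨ cong (2 *_) (∑-multisets-2 H H-sym C) ⟩
  2 * ((∑[ x ∈ C ] ∑[ y ∈ C ] H (x ∷ y ∷ [])) + (∑[ x ∈ C ] H (x ∷ x ∷ [])))
    ≡⟨ cong (λ d → 2 * ((∑[ x ∈ C ] ∑[ y ∈ C ] H (x ∷ y ∷ [])) + d))
            (trans (∑-cong C H-diag) (∑-zero C)) ⟩
  2 * ((∑[ x ∈ C ] ∑[ y ∈ C ] H (x ∷ y ∷ [])) + 0)
    ≡⟨ cong (2 *_) (+-identityʳ (∑[ x ∈ C ] ∑[ y ∈ C ] H (x ∷ y ∷ []))) ⟩
  2 * (∑[ x ∈ C ] ∑[ y ∈ C ] H (x ∷ y ∷ []))
    ≡⟨ sym (trans (∑-cong C λ x → ∑-*ˡ 2 (λ y → H (x ∷ y ∷ [])) C)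
                  (∑-*ˡ 2 (λ x → ∑[ y ∈ C ] H (x ∷ y ∷ [])) C)) ⟩
  ∑[ x ∈ C ] ∑[ y ∈ C ] 2 * H (x ∷ y ∷ [])
    ≡⟨ ∑-cong C (λ x → ∑-cong C (λ y → ordered x y)) ⟩
  ∑-tuples n (λ vs → toℕ (brindled (prefix0011 vs))) ∎
  where
  open ≡-Reasoning
  C = cube n
  G : List (Vec Bool n) → List (Vec Bool n) → ℕ
  G a b = toℕ (brindled (prefixed a b))
  H : List (Vec Bool n) → ℕ
  H a = ∑ (G a) (multisets 2 C)
  H-sym : ∀ x y → H (x ∷ y ∷ []) ≡ H (y ∷ x ∷ [])
  H-sym x y = ∑-cong (multisets 2 C) λ b →
    cong toℕ (brindled-↭ (swap (false ∷ x) (false ∷ y) (↭-refl {xs = map (true ∷_) b})))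
  H-diag : ∀ x → H (x ∷ x ∷ []) ≡ 0
  H-diag x = trans (∑-cong (multisets 2 C) λ b → cong toℕ (brindled-repeat (false ∷ x) (map (true ∷_) b)))
                   (∑-zero (multisets 2 C))
  ordered : ∀ x y → 2 * H (x ∷ y ∷ []) ≡ ∑[ z ∈ C ] ∑[ w ∈ C ] G (x ∷ y ∷ []) (z ∷ w ∷ [])
  ordered x y = trans (∑-multisets-2 (G (x ∷ y ∷ [])) G-sym C)
                      (trans (cong (ordered-sum +_) (trans (∑-cong C G-diag) (∑-zero C))) (+-identityʳ ordered-sum))
    where
    xy = map (false ∷_) (x ∷ y ∷ [])
    ordered-sum = ∑[ z ∈ C ] ∑[ w ∈ C ] G (x ∷ y ∷ []) (z ∷ w ∷ [])
    G-sym : ∀ z w → G (x ∷ y ∷ []) (z ∷ w ∷ []) ≡ G (x ∷ y ∷ []) (w ∷ z ∷ [])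
    G-sym z w = cong toℕ (brindled-↭ (++⁺ˡ xy (swap (true ∷ z) (true ∷ w) (↭-refl {xs = []}))))
    G-diag : ∀ z → G (x ∷ y ∷ []) (z ∷ z ∷ []) ≡ 0
    G-diag z = cong toℕ (trans (brindled-↭ (++-comm xy ((true ∷ z) ∷ (true ∷ z) ∷ [])))
                               (brindled-repeat (true ∷ z) xy))

toℕ-distinct+equal : ∀ c p e e′ → c ∧ e ≡ c ∧ e′ →
  toℕ (((c ∧ p) ∧ not e) ∧ not e′) + toℕ ((c ∧ e) ∧ p) ≡ toℕ (c ∧ p)
toℕ-distinct+equal false p     e     e′     _    = refl
toℕ-distinct+equal true  true  true  .true  refl = refl
toℕ-distinct+equal true  true  false .false refl = refl
toℕ-distinct+equal true  false true  .true  refl = refl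
toℕ-distinct+equal true  false false .false refl = refl

W-via-column-counts : (n : ℕ) → 4 * W n + mixedCount 2 0 n ≡ mixedCount 6 4 n
W-via-column-counts n = begin
  4 * W n + mixedCount 2 0 n
    ≡⟨ cong₂ _+_ (W-ordered n)
                 (sym (trans (count-pairedBalanced n evenEvenOddOdd)
                             (only-last (evenCount 2 0 n) (oddCount 2 0 n) (mixedCount 2 0 n)))) ⟩
  ∑-tuples n (λ vs → toℕ (brindled (prefix0011 vs))) + count pairedBalanced n evenEvenOddOdd
    ≡⟨ sym (∑-tuples-+ n (λ vs → toℕ (brindled (prefix0011 vs)))
                         (λ vs → toℕ (fits pairedBalanced vs evenEvenOddOdd))) ⟩
  ∑-tuples n (λ vs → toℕ (brindled (prefix0011 vs)) + toℕ (fits pairedBalanced vs evenEvenOddOdd))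
    ≡⟨ ∑-tuples-cong n split ⟩
  count balanced n evenEvenOddOdd
    ≡⟨ trans (count-balanced n evenEvenOddOdd) (only-last (evenCount 6 4 n) (oddCount 6 4 n) (mixedCount 6 4 n)) ⟩
  mixedCount 6 4 n ∎
  where
  open ≡-Reasoning
  only-last : ∀ x y z → x * 0 + y * 0 + z * 1 ≡ z
  only-last = solve-∀
  split : (vs : Vec (Vec Bool n) 4) →
          toℕ (brindled (prefix0011 vs)) + toℕ (fits pairedBalanced vs evenEvenOddOdd) ≡
          toℕ (fits balanced vs evenEvenOddOdd)
  split vs@(x ∷ y ∷ z ∷ w ∷ []) =
    trans (cong₂ (λ u v → toℕ u + toℕ v) (brindled-prefix0011 x y z w)
                 (cong (_∧ hasParities vs evenEvenOddOdd) (columnsIn-agree balanced (# 0) (# 1) vs)))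
          (toℕ-distinct+equal (columnsIn balanced vs) (hasParities vs evenEvenOddOdd) (eqV x y) (eqV z w)
                              (columnsIn-balanced-pairs x y z w))

-- Closed forms

mixedCount-6-4-rec : ∀ m → mixedCount 6 4 (suc m) + 2 * mixedCount 6 4 m ≡ 6 ^ m
mixedCount-6-4-rec zero    = refl
mixedCount-6-4-rec (suc m) =
  trans (regroup (mixedCount 6 4 m) (mixedCount 6 4 (suc m))) (cong (6 *_) (mixedCount-6-4-rec m))
  where
  regroup : ∀ d d′ → 6 * d + 6 * d + 4 * d′ + 2 * d′ ≡ 6 * (d′ + 2 * d)
  regroup = solve-∀

next-even-closed-form : ∀ a b p q → a + 2 * b ≡ q → 8 * b ≡ q + p → 8 * a + 2 * p ≡ 6 * q
next-even-closed-form a b p q rec closed = +-cancelʳ-≡ (2 * q) (8 * a + 2 * p) (6 * q) (begin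
  8 * a + 2 * p + 2 * q  ≡⟨ solve₁ a p q ⟩
  8 * a + 2 * (q + p)    ≡⟨ cong (λ u → 8 * a + 2 * u) (sym closed) ⟩
  8 * a + 2 * (8 * b)    ≡⟨ solve₂ a b ⟩
  8 * (a + 2 * b)        ≡⟨ cong (8 *_) rec ⟩
  8 * q                  ≡⟨ solve₃ q ⟩
  6 * q + 2 * q          ∎)
  where
  open ≡-Reasoning
  solve₁ : ∀ a p q → 8 * a + 2 * p + 2 * q ≡ 8 * a + 2 * (q + p)
  solve₁ = solve-∀
  solve₂ : ∀ a b → 8 * a + 2 * (8 * b) ≡ 8 * (a + 2 * b)
  solve₂ = solve-∀
  solve₃ : ∀ q → 8 * q ≡ 6 * q + 2 * q
  solve₃ = solve-∀

next-odd-closed-form : ∀ a c p q → c + 2 * a ≡ q → 8 * a + p ≡ q → 8 * c ≡ 6 * q + 2 * p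
next-odd-closed-form a c p q rec closed = +-cancelʳ-≡ (2 * q) (8 * c) (6 * q + 2 * p) (begin
  8 * c + 2 * q            ≡⟨ cong (λ u → 8 * c + 2 * u) (sym closed) ⟩
  8 * c + 2 * (8 * a + p)  ≡⟨ solve₁ a c p ⟩
  8 * (c + 2 * a) + 2 * p  ≡⟨ cong (λ u → 8 * u + 2 * p) rec ⟩
  8 * q + 2 * p            ≡⟨ solve₂ p q ⟩
  6 * q + 2 * p + 2 * q    ∎)
  where
  open ≡-Reasoning
  solve₁ : ∀ a c p → 8 * c + 2 * (8 * a + p) ≡ 8 * (c + 2 * a) + 2 * p
  solve₁ = solve-∀
  solve₂ : ∀ p q → 8 * q + 2 * p ≡ 6 * q + 2 * p + 2 * q
  solve₂ = solve-∀

-- 8 · mixedCount 6 4 m = 6 ^ m − (−2) ^ m, split by the parity of m to stay in ℕ.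
mixedCount-6-4-closed : ∀ k → (8 * mixedCount 6 4 (k * 2) + 2 ^ (k * 2) ≡ 6 ^ (k * 2))
                            × (8 * mixedCount 6 4 (suc (k * 2)) ≡ 6 ^ suc (k * 2) + 2 ^ suc (k * 2))
mixedCount-6-4-closed zero    = refl , refl
mixedCount-6-4-closed (suc k) = even , odd
  where
  D = mixedCount 6 4
  even : 8 * D (suc k * 2) + 2 ^ (suc k * 2) ≡ 6 ^ (suc k * 2)
  even = next-even-closed-form (D (suc k * 2)) (D (suc (k * 2))) (2 ^ suc (k * 2)) (6 ^ suc (k * 2))
                               (mixedCount-6-4-rec (suc (k * 2))) (proj₂ (mixedCount-6-4-closed k))
  odd : 8 * D (suc (suc k * 2)) ≡ 6 ^ suc (suc k * 2) + 2 ^ suc (suc k * 2)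
  odd = next-odd-closed-form (D (suc k * 2)) (D (suc (suc k * 2))) (2 ^ (suc k * 2)) (6 ^ (suc k * 2))
                             (mixedCount-6-4-rec (suc k * 2)) even

mixedCount-2-0-rec : ∀ m → mixedCount 2 0 (suc (suc m)) ≡ 4 * mixedCount 2 0 m
mixedCount-2-0-rec m = quadruple (mixedCount 2 0 m) (mixedCount 2 0 (suc m))
  where
  quadruple : ∀ e e′ → 2 * e + 2 * e + 0 * e′ ≡ 4 * e
  quadruple = solve-∀

mixedCount-2-0-closed : ∀ k → (mixedCount 2 0 (k * 2) ≡ 0) × (mixedCount 2 0 (suc (k * 2)) ≡ 2 ^ (k * 2))
mixedCount-2-0-closed zero    = refl , refl
mixedCount-2-0-closed (suc k) =
  trans (mixedCount-2-0-rec (k * 2)) (cong (4 *_) (proj₁ (mixedCount-2-0-closed k))) ,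
  trans (mixedCount-2-0-rec (suc (k * 2)))
        (trans (cong (4 *_) (proj₂ (mixedCount-2-0-closed k))) (four (2 ^ (k * 2))))
  where
  four : ∀ p → 4 * p ≡ 2 * (2 * p)
  four = solve-∀

W-even : ∀ k → 32 * W (k * 2) + 2 ^ (k * 2) ≡ 6 ^ (k * 2)
W-even k = trans (cong (_+ 2 ^ n) (trans (*-assoc 8 4 (W n)) (cong (8 *_) 4W≡mixed)))
                 (proj₁ (mixedCount-6-4-closed k))
  where
  n = k * 2
  4W≡mixed : 4 * W n ≡ mixedCount 6 4 n
  4W≡mixed = trans (sym (+-identityʳ (4 * W n)))
                   (trans (cong (4 * W n +_) (sym (proj₁ (mixedCount-2-0-closed k)))) (W-via-column-counts n))

W-odd : ∀ k → 32 * W (suc (k * 2)) + 3 * 2 ^ suc (k * 2) ≡ 6 ^ suc (k * 2)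
W-odd k = cancel (W n) (2 ^ (k * 2)) (6 ^ n) (trans (cong (8 *_) 4W+p≡mixed) (proj₂ (mixedCount-6-4-closed k)))
  where
  n = suc (k * 2)
  4W+p≡mixed : 4 * W n + 2 ^ (k * 2) ≡ mixedCount 6 4 n
  4W+p≡mixed = trans (cong (4 * W n +_) (sym (proj₂ (mixedCount-2-0-closed k)))) (W-via-column-counts n)
  cancel : ∀ w p q → 8 * (4 * w + p) ≡ q + 2 * p → 32 * w + 3 * (2 * p) ≡ q
  cancel w p q eq = +-cancelʳ-≡ (2 * p) (32 * w + 3 * (2 * p)) q (trans (expand w p) eq)
    where
    expand : ∀ w p → 32 * w + 3 * (2 * p) + 2 * p ≡ 8 * (4 * w + p)
    expand = solve-∀

lemma11 : (n : ℕ) →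
    (n % 2 ≡ 0 → 32 * W n + 2 ^ n ≡ 6 ^ n) ×
    (n % 2 ≡ 1 → 32 * W n + 3 * 2 ^ n ≡ 6 ^ n)
lemma11 n =
  (λ n%2≡0 → subst (λ m → 32 * W m + 2 ^ m ≡ 6 ^ m) (sym (halves n%2≡0)) (W-even (n / 2))) ,
  (λ n%2≡1 → subst (λ m → 32 * W m + 3 * 2 ^ m ≡ 6 ^ m) (sym (halves n%2≡1)) (W-odd (n / 2)))
  where
  halves : ∀ {r} → n % 2 ≡ r → n ≡ r + n / 2 * 2
  halves n%2≡r = trans (m≡m%n+[m/n]*n n 2) (cong (_+ n / 2 * 2) n%2≡r)
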